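{- For every $\lambda H$-term $U$, every sequence of $J$-reduction steps starting from $U$ is finite.
   Context: $\lambda H$-terms are the $\lambda$-terms built from variables and one additional constant $H$ by abstraction and application. Application is left-associative. The $J$-reduction is the head reduction step $\lambda\overline{x}\,H\,U_1U_2U_3\ldots U_n\rightarrow_J\lambda\overline{x}\,U_1\,(H\,U_2)\,U_3\ldots U_n$ for $n\ge2$, and $\lambda\overline{x}\,H\,U_1\rightarrow_J\lambda\overline{x}\,U_1$ ($\lambda\overline{x}$ a possibly empty sequence of abstractions). -}

module Defs where

open import Data.Nat using (ℕ)
open import Data.List using (List; []; _∷_; foldl)

-- λH-terms: untyped λ-terms (de Bruijn indices, so α-equivalent terms coincide)
-- built from variables, the constant H, abstraction and application.
data Term : Set where
  var : ℕ → Term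
  H   : Term
  lam : Term → Term
  app : Term → Term → Term

apps : Term → List Term → Term
apps t us = foldl app t us

data _→J_ : Term → Term → Set where
  J-many : ∀ u₁ u₂ us → apps H (u₁ ∷ u₂ ∷ us) →J apps u₁ (app H u₂ ∷ us)
  J-one  : ∀ u₁ → app H u₁ →J u₁
  J-lam  : ∀ {t t'} → t →J t' → lam t →J lam t'

-- "t' is reached from t in one J-step"; well-foundedness of this relation
-- means every J-reduction sequence is finite (strong normalisation).
_J←_ : Term → Term → Set
t' J← t = t →J t'

-- Since
-- the head of an application counts double, moving H from the head of
-- H U₁ U₂ into the argument H U₂ lowers the weight by one, and dropping H in
-- H U₁ lowers it as well; so every J-step strictly decreases the weight.
module Submission where

open import Defs
open import Induction.WellFounded using (WellFounded; module Subrelation)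
open import Data.Nat using (ℕ; suc; _+_; _*_; _<_)
open import Data.Nat.Properties using (+-suc; *-suc; +-monoˡ-<; *-monoʳ-<; ≤-reflexive; n<1+n)
open import Data.Nat.Induction using (<-wellFounded)
open import Data.List using ([]; _∷_)
open import Relation.Binary.PropositionalEquality using (cong; sym; module ≡-Reasoning)
import Relation.Binary.Construct.On as On

weight : Term → ℕ
weight (var _)   = 0
weight H         = 0
weight (lam t)   = weight t
weight (app t u) = 2 * weight t + suc (weight u)

weight-apps-monoˡ-< : ∀ {t t'} us → weight t < weight t' → weight (apps t us) < weight (apps t' us)
weight-apps-monoˡ-< []       w< = w<
weight-apps-monoˡ-< (u ∷ us) w< = weight-apps-monoˡ-< us (+-monoˡ-< (suc (weight u)) (*-monoʳ-< 2 w<))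

weight-shiftH-< : ∀ a b → weight (app a (app H b)) < weight (app (app H a) b)
weight-shiftH-< a b = ≤-reflexive (begin
  suc (2 * weight a + suc (suc (weight b)))  ≡⟨ cong suc (+-suc (2 * weight a) (suc (weight b))) ⟩
  suc (suc (2 * weight a + suc (weight b)))  ≡⟨ cong (_+ suc (weight b)) (sym (*-suc 2 (weight a))) ⟩
  2 * suc (weight a) + suc (weight b)        ∎)
  where open ≡-Reasoning

→J-weight-< : ∀ {t t'} → t →J t' → weight t' < weight t
→J-weight-< (J-many u₁ u₂ us) = weight-apps-monoˡ-< us (weight-shiftH-< u₁ u₂)
→J-weight-< (J-one u₁)        = n<1+n (weight u₁)
→J-weight-< (J-lam t→t')      = →J-weight-< t→t'

lemma3p12 : WellFounded _J←_
lemma3p12 = Subrelation.wellFounded →J-weight-< (On.wellFounded weight <-wellFounded)
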